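{- If $v = (a,b,c,d)$, define $||v||^2 = \langle v, vJ \rangle$. Then $||v||^2 = a^2 + \mathrm{tr}(b,b) + \mathrm{tr}(c,c) + d^2$, and hence if $v \in W(\mathbb{R})$, $||v||^2 \geq 0$ and is only $0$ when $v = 0$. If furthermore $v$ is of rank one, then $|\langle r(i),v \rangle|^2 = ||v||^2$.
   Context: $B_{\mathbb{R}}$ is the Hamilton quaternions, $W=\mathbb{R}\oplus H_3(B_{\mathbb{R}})\oplus H_3(B_{\mathbb{R}})\oplus\mathbb{R}$ the Freudenthal space with symplectic form $\langle(a,b,c,d),(a',b',c',d')\rangle=ad'-\mathrm{tr}(b,c')+\mathrm{tr}(c,b')-da'$, where $\mathrm{tr}(x,y)=\frac12\mathrm{tr}(xy+yx)$. $J$ is the element of the similitude group acting by $(a,b,c,d)\mapsto(-d,c,-b,a)$. $r(i)=(1,-i1_3,(i1_3)^\#,-N(i1_3))=(1,-i1_3,-1_3,i)\in W\otimes\mathbb{C}$, with $i$ the complex unit (central). A nonzero $(a,b,c,d)$ has rank one iff $b^\#=ac$, $c^\#=db$, $bc=cb$, $ad=bc$. -}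

module Defs where

open import Level using (0ℓ)
open import Data.Fin using (Fin; zero; suc)
open import Data.Product using (Σ; ∃; _×_; _,_)
open import Relation.Binary.PropositionalEquality using (_≡_)
open import Relation.Nullary using (¬_)
open import Relation.Binary.Structures using (IsTotalOrder)
open import Algebra.Structures using (IsCommutativeRing)

-- The real numbers, axiomatised as a complete ordered field
-- (any model is isomorphic to ℝ).  Equality is propositional.
-- ½ is included as a datum (it is uniquely determined by ½-spec).

record RealField : Set₁ where
  infixl 6 _+_
  infixl 7 _*_
  infix  4 _≤_
  field
    ℝ      : Set
    0# 1#  : ℝ
    _+_ _*_ : ℝ → ℝ → ℝ
    -_     : ℝ → ℝ
    _≤_    : ℝ → ℝ → Set
    isCommutativeRing : IsCommutativeRing _≡_ _+_ _*_ -_ 0# 1#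
    0≢1    : ¬ (0# ≡ 1#)
    inverse : ∀ x → ¬ (x ≡ 0#) → Σ ℝ (λ y → x * y ≡ 1#)
    isTotalOrder : IsTotalOrder _≡_ _≤_
    +-mono : ∀ {x y} z → x ≤ y → x + z ≤ y + z
    *-nonneg : ∀ {x y} → 0# ≤ x → 0# ≤ y → 0# ≤ x * y
    complete : (P : ℝ → Set) → ∃ P → (∃ λ u → ∀ x → P x → x ≤ u) →
               ∃ λ s → (∀ x → P x → x ≤ s) × (∀ u → (∀ x → P x → x ≤ u) → s ≤ u)
    ½      : ℝ
    ½-spec : ½ * (1# + 1#) ≡ 1#

module WithReals (Rf : RealField) where
  open RealField Rf public

  _-_ : ℝ → ℝ → ℝ
  x - y = x + (- y)
  infixl 6 _-_

  record Quat : Set where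
    constructor quat
    field re qi qj qk : ℝ
  open Quat public

  _+ℍ_ : Quat → Quat → Quat
  quat a b c d +ℍ quat a' b' c' d' = quat (a + a') (b + b') (c + c') (d + d')

  -ℍ_ : Quat → Quat
  -ℍ quat a b c d = quat (- a) (- b) (- c) (- d)

  _*ℍ_ : Quat → Quat → Quat
  quat a1 b1 c1 d1 *ℍ quat a2 b2 c2 d2 =
    quat (a1 * a2 - b1 * b2 - c1 * c2 - d1 * d2)
         (a1 * b2 + b1 * a2 + c1 * d2 - d1 * c2)
         (a1 * c2 - b1 * d2 + c1 * a2 + d1 * b2)
         (a1 * d2 + b1 * c2 - c1 * b2 + d1 * a2)

  conj : Quat → Quat
  conj (quat a b c d) = quat a (- b) (- c) (- d)

  ι : ℝ → Quat
  ι x = quat x 0# 0# 0#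

  0ℍ : Quat
  0ℍ = ι 0#

  Mat : Set
  Mat = Fin 3 → Fin 3 → Quat

  _+M_ : Mat → Mat → Mat
  (X +M Y) i j = X i j +ℍ Y i j

  _*M_ : Mat → Mat → Mat
  (X *M Y) i j = (X i zero *ℍ Y zero j) +ℍ ((X i (suc zero) *ℍ Y (suc zero) j)
                  +ℍ (X i (suc (suc zero)) *ℍ Y (suc (suc zero)) j))

  _·M_ : ℝ → Mat → Mat
  (s ·M X) i j = ι s *ℍ X i j

  _≈M_ : Mat → Mat → Set
  X ≈M Y = ∀ i j → X i j ≡ Y i j

  1M : Mat
  1M zero zero = ι 1#
  1M (suc zero) (suc zero) = ι 1#
  1M (suc (suc zero)) (suc (suc zero)) = ι 1#
  1M _ _ = 0ℍ

  -- trace of a matrix (real part; for the Hermitian-type sums used below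
  -- the trace is real)
  trM : Mat → ℝ
  trM X = re (X zero zero +ℍ (X (suc zero) (suc zero) +ℍ X (suc (suc zero)) (suc (suc zero))))

  -- H_3(B_ℝ): Hermitian 3×3 matrices
  --   [ c1        a3       conj a2 ]
  --   [ conj a3   c2       a1      ]
  --   [ a2        conj a1  c3      ]
  record H3 : Set where
    constructor herm
    field c1 c2 c3 : ℝ
          a1 a2 a3 : Quat
  open H3 public

  toMat : H3 → Mat
  toMat x zero zero = ι (c1 x)
  toMat x zero (suc zero) = a3 x
  toMat x zero (suc (suc zero)) = conj (a2 x)
  toMat x (suc zero) zero = conj (a3 x)
  toMat x (suc zero) (suc zero) = ι (c2 x)
  toMat x (suc zero) (suc (suc zero)) = a1 x
  toMat x (suc (suc zero)) zero = a2 x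
  toMat x (suc (suc zero)) (suc zero) = conj (a1 x)
  toMat x (suc (suc zero)) (suc (suc zero)) = ι (c3 x)

  0H : H3
  0H = herm 0# 0# 0# 0ℍ 0ℍ 0ℍ

  1H : H3
  1H = herm 1# 1# 1# 0ℍ 0ℍ 0ℍ

  -H_ : H3 → H3
  -H herm x y z p q r = herm (- x) (- y) (- z) (-ℍ p) (-ℍ q) (-ℍ r)

  trPair : H3 → H3 → ℝ
  trPair x y = ½ * trM ((toMat x *M toMat y) +M (toMat y *M toMat x))

  T : H3 → ℝ
  T x = trM (toMat x)

  S : H3 → ℝ
  S x = ½ * (T x * T x - trM (toMat x *M toMat x))

  sharp : H3 → Mat
  sharp x = ((toMat x *M toMat x) +M ((- T x) ·M toMat x)) +M (S x ·M 1M)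

  record W : Set where
    constructor mkW
    field wa : ℝ
          wb wc : H3
          wd : ℝ
  open W public

  0W : W
  0W = mkW 0# 0H 0H 0#

  ⟪_,_⟫ : W → W → ℝ
  ⟪ mkW a b c d , mkW a' b' c' d' ⟫ = a * d' - trPair b c' + trPair c b' - d * a'

  _·J : W → W
  mkW a b c d ·J = mkW (- d) c (-H b) a

  ‖_‖² : W → ℝ
  ‖ v ‖² = ⟪ v , v ·J ⟫

  RankOne : W → Set
  RankOne v@(mkW a b c d) =
    ¬ (v ≡ 0W) ×
    (sharp b ≈M (a ·M toMat c)) ×
    (sharp c ≈M (d ·M toMat b)) ×
    ((toMat b *M toMat c) ≈M (toMat c *M toMat b)) ×
    (((a * d) ·M 1M) ≈M (toMat b *M toMat c))

  -- W ⊗ ℂ : pairs (u₁, u₂) standing for u₁ + i u₂ (i central);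
  -- complex numbers as pairs (x, y) = x + i y.
  record ℂ : Set where
    constructor _+i_
    field reC imC : ℝ
  open ℂ public

  record WC : Set where
    constructor _+iW_
    field reW imW : W
  open WC public

  embed : W → WC
  embed v = v +iW 0W

  ⟪_,_⟫ℂ : WC → WC → ℂ
  ⟪ u₁ +iW u₂ , v₁ +iW v₂ ⟫ℂ =
    (⟪ u₁ , v₁ ⟫ - ⟪ u₂ , v₂ ⟫) +i (⟪ u₁ , v₂ ⟫ + ⟪ u₂ , v₁ ⟫)

  ∣_∣² : ℂ → ℝ
  ∣ x +i y ∣² = x * x + y * y

  -- r(i) = (1, −i·1₃, −1₃, i)
  r-i : WC
  r-i = mkW 1# 0H (-H 1H) 0# +iW mkW 0# (-H 1H) 0H 1#

-- Everything reduces to a few polynomial identities in the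
-- coordinates of a Hermitian matrix x (and the constant ½):
--   tr(x, −x) = −tr(x, x),  tr(x, x) = Σ (coordinates)²,
--   tr(x, x) = T(x)² − 2 S(x),  tr(x^#) = S(x),  tr(−1₃, x) = −T(x), ...
-- Then
--   (1) ‖v‖² = a² + tr(b,b) + tr(c,c) + d² is bilinearity of the trace form;
--   (2),(3) ‖v‖² is a sum of squares of the coordinates of v; it is therefore
--       nonnegative, and it vanishes only if every coordinate does, since a
--       real with zero square is zero (this uses completeness of ℝ);
--   (4) ⟨r(i), v⟩ = (d − T(b)) + i (T(c) − a), and taking the trace of the
--       rank-one conditions b^# = a c, c^# = d b gives S(b) = a T(c) and
--       S(c) = d T(b); completing squares turns |⟨r(i), v⟩|² into
--       a² + (T(b)² − 2S(b)) + (T(c)² − 2S(c)) + d² = ‖v‖².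
module Submission where

open import Level using (0ℓ)
open import Algebra.Bundles using (CommutativeRing)
open import Data.Nat.Base as ℕ using (ℕ; zero; suc)
import Data.Nat.Properties as ℕ
open import Data.Integer.Base as ℤ using (ℤ; -[1+_])
import Data.Integer.Properties as ℤ
open import Data.Sign.Base as Sign using (Sign)
open import Data.Maybe.Base using (Maybe; just; nothing)
open import Data.Sum.Base using (inj₁; inj₂)
open import Data.Product.Base using (_×_; _,_)
open import Data.Empty using (⊥-elim)
open import Data.Fin using (Fin; zero; suc; #_)
open import Data.Vec.Base using (Vec; []; _∷_)
open import Data.List.Base using (List; []; _∷_; _++_)
open import Data.List.Relation.Unary.All using (All; []; _∷_)
open import Data.List.Relation.Unary.All.Properties using (++⁻)
open import Relation.Nullary.Decidable using (yes; no)
open import Relation.Binary.PropositionalEquality as ≡ using (_≡_)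
open import Relation.Binary.Structures using (IsTotalOrder)
import Algebra.Solver.Ring.AlmostCommutativeRing as ACR
import Algebra.Properties.Semiring.Mult.TCOptimised as SemiringMult
import Algebra.Properties.Ring as RingProperties
import Algebra.Properties.AbelianGroup as AbelianGroupProperties
open import Defs

-- The ring solver over an arbitrary commutative ring with integer
-- coefficients: the canonical map ℤ → R is a ring morphism, and equality of
-- integers is decidable, so coefficients can be compared during normalisation.
module IntegerCoefficients {c ℓ} (R : CommutativeRing c ℓ) where

  open CommutativeRing R
  open SemiringMult semiring using (1+×; ×-homo-+; ×1-homo-*) renaming (_×_ to _·ℕ_)
  open RingProperties ring using (-‿distribˡ-*; -‿distribʳ-*)
  open AbelianGroupProperties +-abelianGroup using (⁻¹-∙-comm; ⁻¹-involutive; ε⁻¹≈ε)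
  open import Relation.Binary.Reasoning.Setoid setoid

  -- The image n·1 of a natural number (1·1 is 1 on the nose, so integer
  -- constants evaluate to the literal 0# and 1# of R).
  ⟦_⟧ℕ : ℕ → Carrier
  ⟦ n ⟧ℕ = n ·ℕ 1#

  ⟦_⟧ : ℤ → Carrier
  ⟦ ℤ.+ n ⟧ = ⟦ n ⟧ℕ
  ⟦ -[1+ n ] ⟧ = - ⟦ suc n ⟧ℕ

  ⊖-homo : ∀ m n → ⟦ m ℤ.⊖ n ⟧ ≈ ⟦ m ⟧ℕ - ⟦ n ⟧ℕ
  ⊖-homo m zero = sym (trans (+-congˡ ε⁻¹≈ε) (+-identityʳ _))
  ⊖-homo zero (suc n) = sym (+-identityˡ _)
  ⊖-homo (suc m) (suc n) = begin
    ⟦ suc m ℤ.⊖ suc n ⟧           ≡⟨ ≡.cong ⟦_⟧ (ℤ.[1+m]⊖[1+n]≡m⊖n m n) ⟩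
    ⟦ m ℤ.⊖ n ⟧                   ≈⟨ ⊖-homo m n ⟩
    ⟦ m ⟧ℕ - ⟦ n ⟧ℕ               ≈⟨ cancel-1 ⟦ m ⟧ℕ ⟦ n ⟧ℕ ⟨
    (1# + ⟦ m ⟧ℕ) - (1# + ⟦ n ⟧ℕ) ≈⟨ +-cong (1+× m 1#) (-‿cong (1+× n 1#)) ⟨
    ⟦ suc m ⟧ℕ - ⟦ suc n ⟧ℕ       ∎
    where
    cancel-1 : ∀ x y → (1# + x) - (1# + y) ≈ x - y
    cancel-1 x y = begin
      (1# + x) - (1# + y)       ≈⟨ +-congˡ (⁻¹-∙-comm 1# y) ⟨
      (1# + x) + (- 1# - y)     ≈⟨ +-congʳ (+-comm 1# x) ⟩
      (x + 1#) + (- 1# - y)     ≈⟨ +-assoc x 1# _ ⟩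
      x + (1# + (- 1# - y))     ≈⟨ +-congˡ (+-assoc 1# (- 1#) (- y)) ⟨
      x + ((1# - 1#) - y)       ≈⟨ +-congˡ (+-congʳ (-‿inverseʳ 1#)) ⟩
      x + (0# - y)              ≈⟨ +-congˡ (+-identityˡ _) ⟩
      x - y                     ∎

  +-homo : ∀ i j → ⟦ i ℤ.+ j ⟧ ≈ ⟦ i ⟧ + ⟦ j ⟧
  +-homo -[1+ m ] -[1+ n ] = begin
    - ⟦ suc (suc (m ℕ.+ n)) ⟧ℕ       ≡⟨ ≡.cong (λ k → - ⟦ k ⟧ℕ) (ℕ.+-suc (suc m) n) ⟨
    - ⟦ suc m ℕ.+ suc n ⟧ℕ           ≈⟨ -‿cong (×-homo-+ 1# (suc m) (suc n)) ⟩
    - (⟦ suc m ⟧ℕ + ⟦ suc n ⟧ℕ)      ≈⟨ ⁻¹-∙-comm _ _ ⟨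
    - ⟦ suc m ⟧ℕ - ⟦ suc n ⟧ℕ        ∎
  +-homo -[1+ m ] (ℤ.+ n) = trans (⊖-homo n (suc m)) (+-comm _ _)
  +-homo (ℤ.+ m) -[1+ n ] = ⊖-homo m (suc n)
  +-homo (ℤ.+ m) (ℤ.+ n) = ×-homo-+ 1# m n

  -- Multiplication is handled through the sign/absolute-value view of ℤ.
  signed : Sign → Carrier → Carrier
  signed Sign.+ x = x
  signed Sign.- x = - x

  signed-cong : ∀ s {x y} → x ≈ y → signed s x ≈ signed s y
  signed-cong Sign.+ x≈y = x≈y
  signed-cong Sign.- x≈y = -‿cong x≈y

  signed-* : ∀ s t x y → signed (s Sign.* t) (x * y) ≈ signed s x * signed t y
  signed-* Sign.+ Sign.+ x y = refl
  signed-* Sign.+ Sign.- x y = -‿distribʳ-* x y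
  signed-* Sign.- Sign.+ x y = -‿distribˡ-* x y
  signed-* Sign.- Sign.- x y = begin
    x * y            ≈⟨ ⁻¹-involutive _ ⟨
    - - (x * y)      ≈⟨ -‿cong (-‿distribʳ-* x y) ⟩
    - (x * - y)      ≈⟨ -‿distribˡ-* x (- y) ⟩
    - x * - y        ∎

  ◃-homo : ∀ s n → ⟦ s ℤ.◃ n ⟧ ≈ signed s ⟦ n ⟧ℕ
  ◃-homo Sign.+ zero = refl
  ◃-homo Sign.- zero = sym ε⁻¹≈ε
  ◃-homo Sign.+ (suc n) = refl
  ◃-homo Sign.- (suc n) = refl

  sign-abs : ∀ i → ⟦ i ⟧ ≈ signed (ℤ.sign i) ⟦ ℤ.∣ i ∣ ⟧ℕ
  sign-abs (ℤ.+ n) = refl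
  sign-abs -[1+ n ] = refl

  *-homo : ∀ i j → ⟦ i ℤ.* j ⟧ ≈ ⟦ i ⟧ * ⟦ j ⟧
  *-homo i j = begin
    ⟦ (ℤ.sign i Sign.* ℤ.sign j) ℤ.◃ (ℤ.∣ i ∣ ℕ.* ℤ.∣ j ∣) ⟧
      ≈⟨ ◃-homo (ℤ.sign i Sign.* ℤ.sign j) (ℤ.∣ i ∣ ℕ.* ℤ.∣ j ∣) ⟩
    signed (ℤ.sign i Sign.* ℤ.sign j) ⟦ ℤ.∣ i ∣ ℕ.* ℤ.∣ j ∣ ⟧ℕ
      ≈⟨ signed-cong (ℤ.sign i Sign.* ℤ.sign j) (×1-homo-* ℤ.∣ i ∣ ℤ.∣ j ∣) ⟩
    signed (ℤ.sign i Sign.* ℤ.sign j) (⟦ ℤ.∣ i ∣ ⟧ℕ * ⟦ ℤ.∣ j ∣ ⟧ℕ)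
      ≈⟨ signed-* (ℤ.sign i) (ℤ.sign j) _ _ ⟩
    signed (ℤ.sign i) ⟦ ℤ.∣ i ∣ ⟧ℕ * signed (ℤ.sign j) ⟦ ℤ.∣ j ∣ ⟧ℕ
      ≈⟨ *-cong (sign-abs i) (sign-abs j) ⟨
    ⟦ i ⟧ * ⟦ j ⟧ ∎

  neg-homo : ∀ i → ⟦ ℤ.- i ⟧ ≈ - ⟦ i ⟧
  neg-homo (ℤ.+ zero) = sym ε⁻¹≈ε
  neg-homo (ℤ.+ suc n) = refl
  neg-homo -[1+ n ] = sym (⁻¹-involutive _)

  morphism : ℤ.+-*-rawRing ACR.-Raw-AlmostCommutative⟶ ACR.fromCommutativeRing R
  morphism = record
    { ⟦_⟧ = ⟦_⟧ ; +-homo = +-homo ; *-homo = *-homo ; -‿homo = neg-homo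
    ; 0-homo = refl ; 1-homo = refl }

  -- Equal integers have equal images; the solver only needs this weak decision.
  coefficient≟ : ∀ i j → Maybe (⟦ i ⟧ ≈ ⟦ j ⟧)
  coefficient≟ i j with i ℤ.≟ j
  ... | yes i≡j = just (reflexive (≡.cong ⟦_⟧ i≡j))
  ... | no _ = nothing

  open import Algebra.Solver.Ring ℤ.+-*-rawRing
    (ACR.fromCommutativeRing R) morphism coefficient≟ public
    using (Polynomial; solve; prove; _:=_; _:+_; _:*_; _:-_; :-_; con; var)

-- The constructions of Defs, restated over an arbitrary signature
-- (A, +, *, −, 0, 1, ½).  Instantiated with polynomials they compute the
-- symbolic value of a trace, a trace form or an adjoint, so that identities
-- about them can be checked by the ring solver; evaluated at the coordinates
-- of a real matrix they unfold to exactly the definitions of Defs.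
module Formulas {A : Set} (_⊕_ _⊛_ : A → A → A) (⊝_ : A → A) (0# 1# ½ : A) where

  infixl 6 _+_ _-_
  infixl 7 _*_

  _+_ _*_ _-_ : A → A → A
  _+_ = _⊕_
  _*_ = _⊛_
  x - y = x + (⊝ y)

  -_ : A → A
  -_ = ⊝_

  record Quat : Set where
    constructor quat
    field re qi qj qk : A
  open Quat public

  _+ℍ_ : Quat → Quat → Quat
  quat a b c d +ℍ quat a' b' c' d' = quat (a + a') (b + b') (c + c') (d + d')

  -ℍ_ : Quat → Quat
  -ℍ quat a b c d = quat (- a) (- b) (- c) (- d)

  _*ℍ_ : Quat → Quat → Quat
  quat a1 b1 c1 d1 *ℍ quat a2 b2 c2 d2 =
    quat (a1 * a2 - b1 * b2 - c1 * c2 - d1 * d2)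
         (a1 * b2 + b1 * a2 + c1 * d2 - d1 * c2)
         (a1 * c2 - b1 * d2 + c1 * a2 + d1 * b2)
         (a1 * d2 + b1 * c2 - c1 * b2 + d1 * a2)

  conj : Quat → Quat
  conj (quat a b c d) = quat a (- b) (- c) (- d)

  ι : A → Quat
  ι x = quat x 0# 0# 0#

  0ℍ : Quat
  0ℍ = ι 0#

  Mat : Set
  Mat = Fin 3 → Fin 3 → Quat

  _+M_ : Mat → Mat → Mat
  (X +M Y) i j = X i j +ℍ Y i j

  _*M_ : Mat → Mat → Mat
  (X *M Y) i j = (X i zero *ℍ Y zero j) +ℍ ((X i (suc zero) *ℍ Y (suc zero) j)
                  +ℍ (X i (suc (suc zero)) *ℍ Y (suc (suc zero)) j))

  _·M_ : A → Mat → Mat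
  (s ·M X) i j = ι s *ℍ X i j

  1M : Mat
  1M zero zero = ι 1#
  1M (suc zero) (suc zero) = ι 1#
  1M (suc (suc zero)) (suc (suc zero)) = ι 1#
  1M _ _ = 0ℍ

  trM : Mat → A
  trM X = re (X zero zero +ℍ (X (suc zero) (suc zero) +ℍ X (suc (suc zero)) (suc (suc zero))))

  record H3 : Set where
    constructor herm
    field c1 c2 c3 : A
          a1 a2 a3 : Quat
  open H3 public

  toMat : H3 → Mat
  toMat x zero zero = ι (c1 x)
  toMat x zero (suc zero) = a3 x
  toMat x zero (suc (suc zero)) = conj (a2 x)
  toMat x (suc zero) zero = conj (a3 x)
  toMat x (suc zero) (suc zero) = ι (c2 x)
  toMat x (suc zero) (suc (suc zero)) = a1 x
  toMat x (suc (suc zero)) zero = a2 x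
  toMat x (suc (suc zero)) (suc zero) = conj (a1 x)
  toMat x (suc (suc zero)) (suc (suc zero)) = ι (c3 x)

  0H : H3
  0H = herm 0# 0# 0# 0ℍ 0ℍ 0ℍ

  1H : H3
  1H = herm 1# 1# 1# 0ℍ 0ℍ 0ℍ

  -H_ : H3 → H3
  -H herm x y z p q r = herm (- x) (- y) (- z) (-ℍ p) (-ℍ q) (-ℍ r)

  trPair : H3 → H3 → A
  trPair x y = ½ * trM ((toMat x *M toMat y) +M (toMat y *M toMat x))

  T : H3 → A
  T x = trM (toMat x)

  S : H3 → A
  S x = ½ * (T x * T x - trM (toMat x *M toMat x))

  sharp : H3 → Mat
  sharp x = ((toMat x *M toMat x) +M ((- T x) ·M toMat x)) +M (S x ·M 1M)

  2# : A
  2# = 1# + 1#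

  -- The defect δ = ½·2 − 1, which vanishes over the reals.  Identities that
  -- hold only because ½ is the inverse of 2 are stated as  L = R + δ·E.
  δ : A
  δ = ½ * 2# - 1#

  sumsq : List A → A
  sumsq [] = 0#
  sumsq (x ∷ xs) = x * x + sumsq xs

  quatCoords : Quat → List A
  quatCoords (quat x y z w) = x ∷ x ∷ y ∷ y ∷ z ∷ z ∷ w ∷ w ∷ []

  hermCoords : H3 → List A
  hermCoords (herm x y z p q r) = x ∷ y ∷ z ∷ quatCoords p ++ quatCoords q ++ quatCoords r

module Lemma4p5 (Rf : RealField) where
  open WithReals Rf

  ℝ-ring : CommutativeRing 0ℓ 0ℓ
  ℝ-ring = record { isCommutativeRing = isCommutativeRing }

  open CommutativeRing ℝ-ring using (+-comm; +-assoc; +-identityˡ; +-identityʳ;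
    *-identityˡ; *-identityʳ; distribˡ; -‿inverseʳ; zeroˡ; zeroʳ; ring)
  open RingProperties ring using (-‿distribˡ-*)
  open IntegerCoefficients ℝ-ring
    using (Polynomial; solve; prove; _:=_; _:+_; _:*_; _:-_; :-_; con; var)
  open ≡.≡-Reasoning

  module ℝ = Formulas _+_ _*_ -_ 0# 1# ½

  :0 :1 : ∀ {n} → Polynomial n
  :0 = con (ℤ.+ 0)
  :1 = con (ℤ.+ 1)

  -- Symbolic Hermitian matrices: polynomials in 17 variables, namely the 15
  -- real coordinates of a matrix X, then ½, then a free scalar s.
  module P = Formulas {Polynomial 17} _:+_ _:*_ :-_ :0 :1 (var (# 15))

  X : P.H3
  X = P.herm (var (# 0)) (var (# 1)) (var (# 2))
        (P.quat (var (# 3)) (var (# 4)) (var (# 5)) (var (# 6)))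
        (P.quat (var (# 7)) (var (# 8)) (var (# 9)) (var (# 10)))
        (P.quat (var (# 11)) (var (# 12)) (var (# 13)) (var (# 14)))

  s : Polynomial 17
  s = var (# 16)

  -- The environment sending X to x and s to t.  A symbolic construction
  -- evaluated in it unfolds to the corresponding construction of Defs at x.
  env : ℝ → H3 → Vec ℝ 17
  env t x = c1 x ∷ c2 x ∷ c3 x ∷ quat-env (a1 x) (quat-env (a2 x) (quat-env (a3 x) (½ ∷ t ∷ [])))
    where
    quat-env : ∀ {n} → Quat → Vec ℝ n → Vec ℝ (4 ℕ.+ n)
    quat-env (quat p q r w) ρ = p ∷ q ∷ r ∷ w ∷ ρ

  drop-δ : ∀ {l r} e → l ≡ r + ℝ.δ * e → l ≡ r
  drop-δ {l} {r} e l≡r+δe = begin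
    l              ≡⟨ l≡r+δe ⟩
    r + ℝ.δ * e    ≡⟨ ≡.cong (λ z → r + z * e) δ≡0 ⟩
    r + 0# * e     ≡⟨ ≡.cong (r +_) (zeroˡ e) ⟩
    r + 0#         ≡⟨ +-identityʳ r ⟩
    r              ∎
    where
    δ≡0 : ℝ.δ ≡ 0#
    δ≡0 = ≡.trans (≡.cong (_- 1#) ½-spec) (-‿inverseʳ 1#)

  trPair-neg : ∀ x → trPair x (-H x) ≡ - trPair x x
  trPair-neg x = prove (env 0# x) (P.trPair X (P.-H X)) (:- P.trPair X X) ≡.refl

  trPair-zeroˡ : ∀ x → trPair 0H x ≡ 0#
  trPair-zeroˡ x = prove (env 0# x) (P.trPair P.0H X) :0 ≡.refl

  trPair-zeroʳ : ∀ x → trPair x 0H ≡ 0#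
  trPair-zeroʳ x = prove (env 0# x) (P.trPair X P.0H) :0 ≡.refl

  trPair-minus-one : ∀ x → trPair (-H 1H) x ≡ - T x
  trPair-minus-one x = drop-δ _
    (prove (env 0# x) (P.trPair (P.-H P.1H) X) (:- P.T X :+ P.δ :* (:- P.T X)) ≡.refl)

  trace-scale : ∀ t x → trM (t ·M toMat x) ≡ t * T x
  trace-scale t x = prove (env t x) (P.trM (s P.·M P.toMat X)) (s :* P.T X) ≡.refl

  trace-adjoint : ∀ x → trM (sharp x) ≡ S x
  trace-adjoint x = drop-δ _ (prove (env 0# x) (P.trM (P.sharp X))
    (P.S X :+ P.δ :* (P.T X :* P.T X :- P.trM (P.toMat X P.*M P.toMat X))) ≡.refl)

  trace-form-adjoint : ∀ x → trPair x x ≡ T x * T x - S x * ℝ.2#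
  trace-form-adjoint x = drop-δ _ (prove (env 0# x) (P.trPair X X)
    (P.T X :* P.T X :- P.S X :* P.2# :+ P.δ :* (P.T X :* P.T X)) ≡.refl)

  -- The real coordinates of a point of W.  An off-diagonal quaternion entry
  -- occurs twice in a Hermitian matrix, so its coordinates are listed twice.
  quatCoords : Quat → List ℝ
  quatCoords (quat x y z w) = x ∷ x ∷ y ∷ y ∷ z ∷ z ∷ w ∷ w ∷ []

  hermCoords : H3 → List ℝ
  hermCoords (herm x y z p q r) = x ∷ y ∷ z ∷ quatCoords p ++ quatCoords q ++ quatCoords r

  wCoords : W → List ℝ
  wCoords (mkW a b c d) = a ∷ d ∷ hermCoords b ++ hermCoords c

  trace-form-sumsq : ∀ x → trPair x x ≡ ℝ.sumsq (hermCoords x)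
  trace-form-sumsq x = drop-δ _ (prove (env 0# x) (P.trPair X X)
    (P.sumsq (P.hermCoords X) :+ P.δ :* P.sumsq (P.hermCoords X)) ≡.refl)

  module ≤ = IsTotalOrder isTotalOrder

  x≤y⇒0≤y-x : ∀ {x y} → x ≤ y → 0# ≤ y - x
  x≤y⇒0≤y-x {x} {y} x≤y = ≡.subst (_≤ y - x) (-‿inverseʳ x) (+-mono (- x) x≤y)

  0≤y-x⇒x≤y : ∀ {x y} → 0# ≤ y - x → x ≤ y
  0≤y-x⇒x≤y {x} {y} 0≤y-x = ≡.subst₂ _≤_ (+-identityˡ x)
    (solve 2 (λ x y → y :- x :+ x := y) ≡.refl x y) (+-mono x 0≤y-x)

  x≤0⇒0≤-x : ∀ {x} → x ≤ 0# → 0# ≤ - x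
  x≤0⇒0≤-x {x} x≤0 = ≡.subst (0# ≤_) (+-identityˡ (- x)) (x≤y⇒0≤y-x x≤0)

  square-nonneg : ∀ x → 0# ≤ x * x
  square-nonneg x with ≤.total 0# x
  ... | inj₁ 0≤x = *-nonneg 0≤x 0≤x
  ... | inj₂ x≤0 = ≡.subst (0# ≤_) (solve 1 (λ x → (:- x) :* (:- x) := x :* x) ≡.refl x)
                     (*-nonneg (x≤0⇒0≤-x x≤0) (x≤0⇒0≤-x x≤0))

  +-nonneg : ∀ {x y} → 0# ≤ x → 0# ≤ y → 0# ≤ x + y
  +-nonneg {x} {y} 0≤x 0≤y = ≤.trans 0≤y (≡.subst (_≤ x + y) (+-identityˡ y) (+-mono y 0≤x))

  nonneg-sum-zeroˡ : ∀ {x y} → 0# ≤ x → 0# ≤ y → x + y ≡ 0# → x ≡ 0#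
  nonneg-sum-zeroˡ {x} {y} 0≤x 0≤y x+y≡0 = ≤.antisym x≤0 0≤x
    where
    x≤0 : x ≤ 0#
    x≤0 = ≡.subst₂ _≤_ (+-identityˡ x) (≡.trans (+-comm y x) x+y≡0) (+-mono x 0≤y)

  nonneg-sum-zeroʳ : ∀ {x y} → 0# ≤ x → 0# ≤ y → x + y ≡ 0# → y ≡ 0#
  nonneg-sum-zeroʳ {x} {y} 0≤x 0≤y x+y≡0 = nonneg-sum-zeroˡ 0≤y 0≤x (≡.trans (+-comm y x) x+y≡0)

  0≤1 : 0# ≤ 1#
  0≤1 = ≡.subst (0# ≤_) (*-identityˡ 1#) (square-nonneg 1#)

  *-monoˡ-≤ : ∀ {x y} z → 0# ≤ z → x ≤ y → z * x ≤ z * y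
  *-monoˡ-≤ {x} {y} z 0≤z x≤y = 0≤y-x⇒x≤y (≡.subst (0# ≤_)
    (solve 3 (λ x y z → z :* (y :- x) := z :* y :- z :* x) ≡.refl x y z)
    (*-nonneg 0≤z (x≤y⇒0≤y-x x≤y)))

  -- ½ is nonnegative: otherwise −1 = (−½)·2 would be nonnegative.
  0≤½ : 0# ≤ ½
  0≤½ with ≤.total 0# ½
  ... | inj₁ 0≤½ = 0≤½
  ... | inj₂ ½≤0 = ⊥-elim (0≢1 (≤.antisym 0≤1 1≤0))
    where
    0≤-1 : 0# ≤ - 1#
    0≤-1 = ≡.subst (0# ≤_) (≡.trans (≡.sym (-‿distribˡ-* ½ ℝ.2#)) (≡.cong -_ ½-spec))
             (*-nonneg (x≤0⇒0≤-x ½≤0) (+-nonneg 0≤1 0≤1))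
    1≤0 : 1# ≤ 0#
    1≤0 = 0≤y-x⇒x≤y (≡.subst (0# ≤_) (≡.sym (+-identityˡ (- 1#))) 0≤-1)

  ½[x+x]≡x : ∀ x → ½ * (x + x) ≡ x
  ½[x+x]≡x x = begin
    ½ * (x + x)         ≡⟨ solve 2 (λ h x → h :* (x :+ x) := x :* (h :* (:1 :+ :1))) ≡.refl ½ x ⟩
    x * (½ * ℝ.2#)      ≡⟨ ≡.cong (x *_) ½-spec ⟩
    x * 1#              ≡⟨ *-identityʳ x ⟩
    x                   ∎

  -- Constructively, x² = 0 ⇒ x = 0 needs the completeness axiom: the set of
  -- reals with zero square contains 0, is bounded by 1, and is closed under
  -- doubling and negation, which forces its supremum to be ≤ 0.
  Nilsquare : ℝ → Set
  Nilsquare y = y * y ≡ 0#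

  -- The reals with zero square are bounded by 1: if 1 ≤ y then
  -- 0 ≤ (y − 1) y = −y, so y ≤ 0.
  nilsquare-≤1 : ∀ y → Nilsquare y → y ≤ 1#
  nilsquare-≤1 y y²≡0 with ≤.total y 1#
  ... | inj₁ y≤1 = y≤1
  ... | inj₂ 1≤y = ≤.trans y≤0 0≤1
    where
    [y-1]y≡-y : (y - 1#) * y ≡ 0# - y
    [y-1]y≡-y = ≡.trans (solve 1 (λ y → (y :- :1) :* y := y :* y :- y) ≡.refl y) (≡.cong (_- y) y²≡0)
    y≤0 : y ≤ 0#
    y≤0 = 0≤y-x⇒x≤y (≡.subst (0# ≤_) [y-1]y≡-y (*-nonneg (x≤y⇒0≤y-x 1≤y) (≤.trans 0≤1 1≤y)))

  nilsquare-double : ∀ {y} → Nilsquare y → Nilsquare (y + y)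
  nilsquare-double {y} y²≡0 = begin
    (y + y) * (y + y)
      ≡⟨ solve 1 (λ y → (y :+ y) :* (y :+ y) := (:1 :+ :1) :* (:1 :+ :1) :* (y :* y)) ≡.refl y ⟩
    ℝ.2# * ℝ.2# * (y * y)  ≡⟨ ≡.cong (ℝ.2# * ℝ.2# *_) y²≡0 ⟩
    ℝ.2# * ℝ.2# * 0#       ≡⟨ zeroʳ _ ⟩
    0#                     ∎

  nilsquare-neg : ∀ {y} → Nilsquare y → Nilsquare (- y)
  nilsquare-neg {y} y²≡0 = ≡.trans (solve 1 (λ y → (:- y) :* (:- y) := y :* y) ≡.refl y) y²≡0

  ≤½x⇒≤0 : ∀ {x} → x ≤ ½ * x → x ≤ 0#
  ≤½x⇒≤0 {x} x≤½x = ≤.trans x≤½x (0≤y-x⇒x≤y (≡.subst (0# ≤_) ½x-x≡-½x (x≤y⇒0≤y-x x≤½x)))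
    where
    ½x-x≡-½x : ½ * x - x ≡ 0# - ½ * x
    ½x-x≡-½x = ≡.trans (≡.cong (λ z → ½ * x - z) (≡.trans (≡.sym (½[x+x]≡x x)) (distribˡ ½ x x)))
                 (solve 1 (λ u → u :- (u :+ u) := :0 :- u) ≡.refl (½ * x))

  -- The supremum σ of the reals with zero square is below ½σ (the set is
  -- closed under doubling), so it is nonpositive, and so is every such real.
  nilsquare-≤0 : ∀ y → Nilsquare y → y ≤ 0#
  nilsquare-≤0 y y²≡0
    with σ , σ-upper , σ-least ← complete Nilsquare (0# , zeroˡ 0#) (1# , nilsquare-≤1)
    = ≤.trans (σ-upper y y²≡0) (≤½x⇒≤0 (σ-least (½ * σ) ½σ-upper))
    where
    ½σ-upper : ∀ z → Nilsquare z → z ≤ ½ * σ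
    ½σ-upper z z²≡0 = ≡.subst (_≤ ½ * σ) (½[x+x]≡x z)
      (*-monoˡ-≤ ½ 0≤½ (σ-upper (z + z) (nilsquare-double z²≡0)))

  -- A real whose square vanishes is zero: both x and −x are ≤ 0.
  square-zero : ∀ x → x * x ≡ 0# → x ≡ 0#
  square-zero x x²≡0 = ≤.antisym (nilsquare-≤0 x x²≡0) 0≤x
    where
    0≤x : 0# ≤ x
    0≤x = ≡.subst (0# ≤_) (solve 1 (λ x → :- (:- x) := x) ≡.refl x)
            (x≤0⇒0≤-x (nilsquare-≤0 (- x) (nilsquare-neg x²≡0)))

  sumsq-nonneg : ∀ xs → 0# ≤ ℝ.sumsq xs
  sumsq-nonneg [] = ≤.refl
  sumsq-nonneg (x ∷ xs) = +-nonneg (square-nonneg x) (sumsq-nonneg xs)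

  sumsq-zero : ∀ xs → ℝ.sumsq xs ≡ 0# → All (_≡ 0#) xs
  sumsq-zero [] _ = []
  sumsq-zero (x ∷ xs) sum≡0 =
    square-zero x (nonneg-sum-zeroˡ (square-nonneg x) (sumsq-nonneg xs) sum≡0)
    ∷ sumsq-zero xs (nonneg-sum-zeroʳ (square-nonneg x) (sumsq-nonneg xs) sum≡0)

  sumsq-++ : ∀ xs ys → ℝ.sumsq (xs ++ ys) ≡ ℝ.sumsq xs + ℝ.sumsq ys
  sumsq-++ [] ys = ≡.sym (+-identityˡ _)
  sumsq-++ (x ∷ xs) ys = ≡.trans (≡.cong (x * x +_) (sumsq-++ xs ys)) (≡.sym (+-assoc _ _ _))

  quat-zero : ∀ p → All (_≡ 0#) (quatCoords p) → p ≡ 0ℍ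
  quat-zero (quat _ _ _ _) (≡.refl ∷ _ ∷ ≡.refl ∷ _ ∷ ≡.refl ∷ _ ∷ ≡.refl ∷ _ ∷ []) = ≡.refl

  herm-zero : ∀ x → All (_≡ 0#) (hermCoords x) → x ≡ 0H
  herm-zero (herm _ _ _ p q r) (≡.refl ∷ ≡.refl ∷ ≡.refl ∷ zeros)
    with p-zeros , qr-zeros ← ++⁻ (quatCoords p) zeros
    with q-zeros , r-zeros ← ++⁻ (quatCoords q) qr-zeros
    rewrite quat-zero p p-zeros | quat-zero q q-zeros | quat-zero r r-zeros = ≡.refl

  w-zero : ∀ v → All (_≡ 0#) (wCoords v) → v ≡ 0W
  w-zero (mkW _ b c _) (≡.refl ∷ ≡.refl ∷ zeros)
    with b-zeros , c-zeros ← ++⁻ (hermCoords b) zeros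
    rewrite herm-zero b b-zeros | herm-zero c c-zeros = ≡.refl

  -- Part (1): ‖v‖² = a² + tr(b,b) + tr(c,c) + d², since the J-twist
  -- contributes −tr(b,−b) = tr(b,b) and −d·(−d) = d².
  norm-expand : ∀ v → ‖ v ‖² ≡ wa v * wa v + trPair (wb v) (wb v) + trPair (wc v) (wc v) + wd v * wd v
  norm-expand (mkW a b c d) = begin
    a * a - trPair b (-H b) + trPair c c - d * - d
      ≡⟨ ≡.cong (λ t → a * a - t + trPair c c - d * - d) (trPair-neg b) ⟩
    a * a - - trPair b b + trPair c c - d * - d
      ≡⟨ solve 4 (λ a d β γ → a :* a :- :- β :+ γ :- d :* :- d := a :* a :+ β :+ γ :+ d :* d)
                 ≡.refl a d (trPair b b) (trPair c c) ⟩
    a * a + trPair b b + trPair c c + d * d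
      ∎

  norm-sumsq : ∀ v → ‖ v ‖² ≡ ℝ.sumsq (wCoords v)
  norm-sumsq v@(mkW a b c d) = begin
    ‖ v ‖²
      ≡⟨ norm-expand v ⟩
    a * a + trPair b b + trPair c c + d * d
      ≡⟨ ≡.cong₂ (λ β γ → a * a + β + γ + d * d) (trace-form-sumsq b) (trace-form-sumsq c) ⟩
    a * a + Σb + Σc + d * d
      ≡⟨ solve 4 (λ a d β γ → a :* a :+ β :+ γ :+ d :* d := a :* a :+ (d :* d :+ (β :+ γ)))
                 ≡.refl a d Σb Σc ⟩
    a * a + (d * d + (Σb + Σc))
      ≡⟨ ≡.cong (λ t → a * a + (d * d + t)) (sumsq-++ (hermCoords b) (hermCoords c)) ⟨
    ℝ.sumsq (wCoords v)
      ∎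
    where
    Σb Σc : ℝ
    Σb = ℝ.sumsq (hermCoords b)
    Σc = ℝ.sumsq (hermCoords c)

  pairing-zero : ∀ u → ⟪ u , 0W ⟫ ≡ 0#
  pairing-zero (mkW a b c d) = begin
    a * 0# - trPair b 0H + trPair c 0H - d * 0#
      ≡⟨ ≡.cong₂ (λ β γ → a * 0# - β + γ - d * 0#) (trPair-zeroʳ b) (trPair-zeroʳ c) ⟩
    a * 0# - 0# + 0# - d * 0#
      ≡⟨ solve 2 (λ a d → a :* :0 :- :0 :+ :0 :- d :* :0 := :0) ≡.refl a d ⟩
    0#
      ∎

  -- r(i) = u₁ + i u₂ with u₁ = (1, 0, −1₃, 0) and u₂ = (0, −1₃, 0, 1);
  -- then ⟨u₁, v⟩ = d − T(b) and ⟨u₂, v⟩ = T(c) − a.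
  pairing-re : ∀ v → ⟪ reW r-i , v ⟫ ≡ wd v - T (wb v)
  pairing-re (mkW a b c d) = begin
    1# * d - trPair 0H c + trPair (-H 1H) b - 0# * a
      ≡⟨ ≡.cong₂ (λ γ β → 1# * d - γ + β - 0# * a) (trPair-zeroˡ c) (trPair-minus-one b) ⟩
    1# * d - 0# + - T b - 0# * a
      ≡⟨ solve 3 (λ a d t → :1 :* d :- :0 :+ :- t :- :0 :* a := d :- t) ≡.refl a d (T b) ⟩
    d - T b
      ∎

  pairing-im : ∀ v → ⟪ imW r-i , v ⟫ ≡ T (wc v) - wa v
  pairing-im (mkW a b c d) = begin
    0# * d - trPair (-H 1H) c + trPair 0H b - 1# * a
      ≡⟨ ≡.cong₂ (λ γ β → 0# * d - γ + β - 1# * a) (trPair-minus-one c) (trPair-zeroˡ b) ⟩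
    0# * d - - T c + 0# - 1# * a
      ≡⟨ solve 3 (λ a d t → :0 :* d :- :- t :+ :0 :- :1 :* a := t :- a) ≡.refl a d (T c) ⟩
    T c - a
      ∎

  pairing-r-i : ∀ v → ⟪ r-i , embed v ⟫ℂ ≡ (wd v - T (wb v)) +i (T (wc v) - wa v)
  pairing-r-i v = ≡.cong₂ _+i_
    (begin
      ⟪ reW r-i , v ⟫ - ⟪ imW r-i , 0W ⟫  ≡⟨ ≡.cong₂ _-_ (pairing-re v) (pairing-zero (imW r-i)) ⟩
      (wd v - T (wb v)) - 0#             ≡⟨ solve 1 (λ t → t :- :0 := t) ≡.refl (wd v - T (wb v)) ⟩
      wd v - T (wb v)                    ∎)
    (begin
      ⟪ reW r-i , 0W ⟫ + ⟪ imW r-i , v ⟫  ≡⟨ ≡.cong₂ _+_ (pairing-zero (reW r-i)) (pairing-im v) ⟩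
      0# + (T (wc v) - wa v)             ≡⟨ +-identityˡ _ ⟩
      T (wc v) - wa v                    ∎)

  trM-cong : ∀ {M N} → M ≈M N → trM M ≡ trM N
  trM-cong M≈N
    rewrite M≈N zero zero | M≈N (suc zero) (suc zero) | M≈N (suc (suc zero)) (suc (suc zero)) = ≡.refl

  adjoint-condition-trace : ∀ a b c → sharp b ≈M (a ·M toMat c) → S b ≡ a * T c
  adjoint-condition-trace a b c b#≈ac = begin
    S b                 ≡⟨ trace-adjoint b ⟨
    trM (sharp b)       ≡⟨ trM-cong b#≈ac ⟩
    trM (a ·M toMat c)  ≡⟨ trace-scale a c ⟩
    a * T c             ∎

  complete-squares : ∀ a d t u → (d - t) * (d - t) + (u - a) * (u - a)
                       ≡ a * a + (t * t - a * u * ℝ.2#) + (u * u - d * t * ℝ.2#) + d * d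
  complete-squares = solve 4 (λ a d t u → (d :- t) :* (d :- t) :+ (u :- a) :* (u :- a)
    := a :* a :+ (t :* t :- a :* u :* (:1 :+ :1)) :+ (u :* u :- d :* t :* (:1 :+ :1)) :+ d :* d) ≡.refl

  -- Part (4): for rank-one v, |⟨r(i), v⟩|² = ‖v‖²; the cross terms of the
  -- squares are 2S(b) and 2S(c), and T(x)² − 2S(x) = tr(x, x).
  rank-one-norm : ∀ v → RankOne v → ∣ ⟪ r-i , embed v ⟫ℂ ∣² ≡ ‖ v ‖²
  rank-one-norm v@(mkW a b c d) (_ , b#≈ac , c#≈db , _ , _) = begin
    ∣ ⟪ r-i , embed v ⟫ℂ ∣²
      ≡⟨ ≡.cong ∣_∣² (pairing-r-i v) ⟩
    (d - T b) * (d - T b) + (T c - a) * (T c - a)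
      ≡⟨ complete-squares a d (T b) (T c) ⟩
    a * a + (T b * T b - a * T c * ℝ.2#) + (T c * T c - d * T b * ℝ.2#) + d * d
      ≡⟨ ≡.cong₂ (λ σ τ → a * a + (T b * T b - σ * ℝ.2#) + (T c * T c - τ * ℝ.2#) + d * d)
                 (adjoint-condition-trace a b c b#≈ac) (adjoint-condition-trace d c b c#≈db) ⟨
    a * a + (T b * T b - S b * ℝ.2#) + (T c * T c - S c * ℝ.2#) + d * d
      ≡⟨ ≡.cong₂ (λ β γ → a * a + β + γ + d * d) (trace-form-adjoint b) (trace-form-adjoint c) ⟨
    a * a + trPair b b + trPair c c + d * d
      ≡⟨ norm-expand v ⟨
    ‖ v ‖²
      ∎

lemma4p5 : (Rf : RealField) → let open WithReals Rf in
    (v : W) →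
    (‖ v ‖² ≡ wa v * wa v + trPair (wb v) (wb v) + trPair (wc v) (wc v) + wd v * wd v)
    × (0# ≤ ‖ v ‖²)
    × (‖ v ‖² ≡ 0# → v ≡ 0W)
    × (RankOne v → ∣ ⟪ r-i , embed v ⟫ℂ ∣² ≡ ‖ v ‖²)
lemma4p5 Rf v =
    norm-expand v
  , ≡.subst (0# ≤_) (≡.sym (norm-sumsq v)) (sumsq-nonneg (wCoords v))
  , (λ ‖v‖²≡0 → w-zero v (sumsq-zero (wCoords v) (≡.trans (≡.sym (norm-sumsq v)) ‖v‖²≡0)))
  , rank-one-norm v
  where
  open WithReals Rf
  open Lemma4p5 Rf
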